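{- There is a zero-error protocol using public randomness for the online set-intersection problem with expected total communication cost $O(k\log\log k+|X\cap Y|\log n)$, where $Y$ is the multiset $\{Y_1,\dots,Y_k\}$ of Bob's inputs.
   Context: Online communication model: Alice receives her whole input $X$ at the start; Bob receives inputs $Y_1,\dots,Y_k$ one at a time. The game has $k$ stages; in stage $i$, $Y_i$ is revealed to Bob, the players communicate (remembering previous transcripts), and Bob must output $f_i(X,Y_i)$ before the next stage; at the end of stage $i$, $Y_i$ is revealed to Alice. Online set-intersection: Alice is given $X\subseteq[n]$ with $|X|=k$; in stage $i$ Bob is given $Y_i\in[n]$ and must output whether $Y_i\in X$. -}

module Defs where

open import Data.Nat using (ℕ; zero; suc; _+_; _*_; _^_; _≤_)
open import Data.Nat.Logarithm using (⌊log₂_⌋)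
open import Data.Bool using (Bool; true; false)
open import Data.Fin using (Fin)
open import Data.Fin.Subset using (Subset; _∈_; ∣_∣)
open import Data.Fin.Subset.Properties using (_∈?_)
open import Data.List using (List; []; _∷_; _++_; [_]; length; map; concatMap; filter)
open import Data.Nat.ListAction using (sum)
open import Data.Vec using (Vec; toList) renaming ([] to []ᵥ; _∷_ to _∷ᵥ_)
open import Data.Product using (_×_; _,_; proj₁; proj₂)
open import Relation.Nullary.Decidable using (⌊_⌋)

-- A = Alice's private input, B = Bob's private input (the current Y_i).
-- At each inner node the speaker (fixed by the node, i.e. by common
-- knowledge) sends one bit computed from its private input; at a leaf
-- Bob outputs a bit computed from his private input.
data Tree (A B : Set) : Set where
  out   : (B → Bool) → Tree A B
  alice : (A → Bool) → (Bool → Tree A B) → Tree A B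
  bob   : (B → Bool) → (Bool → Tree A B) → Tree A B

run : {A B : Set} → Tree A B → A → B → List Bool × Bool
run (out o)     a b = [] , o b
run (alice m k) a b with run (k (m a)) a b
... | t , o = m a ∷ t , o
run (bob m k)   a b with run (k (m b)) a b
... | t , o = m b ∷ t , o

-- Common history after some stages: the revealed Y_j together with the
-- transcript of stage j, for each past stage j (in order).
History : ℕ → Set
History n = List (Fin n × List Bool)

-- An online protocol for universe [n] using R public random bits:
-- for each public random string and each common history, the tree
-- used in the next stage.  Alice's private input is X (a subset of
-- [n]); Bob's private input in the stage is Y_i (everything else he
-- knows - previous Y_j and transcripts - is in the history).
Protocol : ℕ → ℕ → Set
Protocol n R = Vec Bool R → History n → Tree (Subset n) (Fin n)

exec : {n : ℕ} → (History n → Tree (Subset n) (Fin n)) → Subset n →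
       History n → List (Fin n) → ℕ × List Bool
exec P X h []       = 0 , []
exec P X h (y ∷ ys) with run (P h) X y
... | t , o with exec P X (h ++ [ (y , t) ]) ys
... | c , os = length t + c , o ∷ os

cost : {n R k : ℕ} → Protocol n R → Vec Bool R → Subset n → Vec (Fin n) k → ℕ
cost P r X Y = proj₁ (exec (P r) X [] (toList Y))

outputs : {n R k : ℕ} → Protocol n R → Vec Bool R → Subset n → Vec (Fin n) k → List Bool
outputs P r X Y = proj₂ (exec (P r) X [] (toList Y))

answers : {n k : ℕ} → Subset n → Vec (Fin n) k → List Bool
answers X Y = map (λ y → ⌊ y ∈? X ⌋) (toList Y)

-- |X ∩ Y| with Y the multiset {Y_1,…,Y_k}.
hits : {n k : ℕ} → Subset n → Vec (Fin n) k → ℕ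
hits X Y = length (filter (_∈? X) (toList Y))

-- All bit strings of length R (uniform distribution of public randomness).
allStrings : (R : ℕ) → List (Vec Bool R)
allStrings zero    = []ᵥ ∷ []
allStrings (suc R) = concatMap (λ r → (false ∷ᵥ r) ∷ (true ∷ᵥ r) ∷ []) (allStrings R)

-- Sum of the cost over all public random strings (= 2^R · expected cost).
totalCost : {n R k : ℕ} → Protocol n R → Subset n → Vec (Fin n) k → ℕ
totalCost {R = R} P X Y = sum (map (λ r → cost P r X Y) (allStrings R))

-- Public coins give every x ∈ [n] a hash: M uniformly random bits followed by the binary code
-- of x, so distinct elements have distinct hashes. In the first stage Alice sends the binary trie
-- of the p-bit hash prefixes of X, where p = log k + log log k + O(1): its top log k levels have
-- O(k) nodes altogether and each further level at most k, so it costs O(k log log k) bits.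
-- In each stage Bob looks the p-bit prefix of his hash up in the trie (one bit); on a hit he
-- reveals further hash bits one at a time, Alice confirming after each that some x ∈ X still
-- matches, until a bit fails (Y_i ∉ X) or the whole hash matches (Y_i ∈ X). This costs about
-- twice the common prefix length of the hashes of Y_i and of some x ∈ X matching it to depth p.
-- For x ≠ Y_i that is nonzero with probability 2 ^ -p, giving expectation O(p / 2 ^ p) = O(1 / k),
-- so all of X together contributes O(1) per stage, while x = Y_i contributes O(log n).

module Submission where

open import Defs
open import Data.Nat using (ℕ; zero; suc; _+_; _*_; _^_; _≤_; _<_; _∸_; z≤n; s≤s; s≤s⁻¹; ⌊_/2⌋; ⌈_/2⌉)
open import Data.Nat.Induction using (<-wellFounded)
open import Data.Nat.Logarithm using (⌊log₂_⌋; ⌊log₂⌋-mono-≤; ⌊log₂[2^n]⌋≡n)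
open import Data.Nat.Logarithm.Core using (⌊log2⌋)
open import Induction.WellFounded using (acc)
open import Data.Nat.Properties hiding (_≟_)
open import Algebra.Properties.CommutativeSemigroup +-commutativeSemigroup using (interchange)
open import Data.Nat.Tactic.RingSolver using (solve-∀)
open import Data.Bool using (Bool; true; false; if_then_else_; _∧_; _∨_; _xor_)
open import Data.Bool.Properties using (xor-same; if-float)
open import Data.Fin using (Fin; zero; suc; toℕ; _≟_)
open import Data.Fin.Properties using (toℕ<n; toℕ-injective)
open import Data.Fin.Subset using (Subset; _∈_; _∉_; ∣_∣; Nonempty)
open import Data.Fin.Subset.Properties using (_∈?_; ∣p∣≤n; nonempty?; Empty-unique; ∣⊥∣≡0)
open import Data.List using (List; []; _∷_; _++_; [_]; _∷ʳ_; length; map; concatMap; take; filter)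
open import Relation.Unary using (Pred; Decidable)
open import Level using (0ℓ)
open import Data.List.Properties using (++-assoc; ++-identityʳ; length-++; length-take; ∷-injectiveˡ; ∷-injectiveʳ)
open import Data.Nat.ListAction using (sum)
import Data.Vec as Vec
open import Data.Vec using (Vec; lookup; here; there)
  renaming ([] to []ᵥ; _∷_ to _∷ᵥ_; _++_ to _++ᵥ_)
open import Data.Vec.Properties using (length-toList)
open import Data.Product using (Σ; ∃; _×_; _,_; proj₁; proj₂)
open import Relation.Binary.PropositionalEquality
  using (_≡_; _≢_; refl; sym; trans; cong; cong₂; subst; module ≡-Reasoning)
open import Data.Empty using (⊥-elim)
open import Relation.Nullary.Decidable using (⌊_⌋; isYes≗does; dec-true; dec-false)
open import Relation.Nullary using (does; yes; no)

private
  variable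
    A A′ : Set
    n : ℕ

indicator : Bool → ℕ
indicator b = if b then 1 else 0

∑ : List A → (A → ℕ) → ℕ
∑ xs f = sum (map f xs)

syntax ∑ xs (λ x → e) = ∑[ x ∈ xs ] e

∑-cong : (xs : List A) {f g : A → ℕ} → (∀ x → f x ≡ g x) → ∑ xs f ≡ ∑ xs g
∑-cong []       eq = refl
∑-cong (x ∷ xs) eq = cong₂ _+_ (eq x) (∑-cong xs eq)

∑-mono-≤ : (xs : List A) {f g : A → ℕ} → (∀ x → f x ≤ g x) → ∑ xs f ≤ ∑ xs g
∑-mono-≤ []       le = z≤n
∑-mono-≤ (x ∷ xs) le = +-mono-≤ (le x) (∑-mono-≤ xs le)

∑-distrib-+ : (xs : List A) (f g : A → ℕ) → ∑[ x ∈ xs ] (f x + g x) ≡ ∑ xs f + ∑ xs g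
∑-distrib-+ []       f g = refl
∑-distrib-+ (x ∷ xs) f g = trans (cong (f x + g x +_) (∑-distrib-+ xs f g)) (interchange (f x) (g x) _ _)

∑-*ˡ : (xs : List A) (c : ℕ) (f : A → ℕ) → ∑[ x ∈ xs ] (c * f x) ≡ c * ∑ xs f
∑-*ˡ []       c f = sym (*-zeroʳ c)
∑-*ˡ (x ∷ xs) c f = trans (cong (c * f x +_) (∑-*ˡ xs c f)) (sym (*-distribˡ-+ c (f x) _))

∑-const : (xs : List A) (c : ℕ) → ∑[ x ∈ xs ] c ≡ length xs * c
∑-const []       c = refl
∑-const (x ∷ xs) c = cong (c +_) (∑-const xs c)

∑-comm : (xs : List A) (ys : List A′) (f : A → A′ → ℕ) →
         ∑[ x ∈ xs ] ∑[ y ∈ ys ] f x y ≡ ∑[ y ∈ ys ] ∑[ x ∈ xs ] f x y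
∑-comm xs []       f = trans (∑-const xs 0) (*-zeroʳ (length xs))
∑-comm xs (y ∷ ys) f = trans (∑-distrib-+ xs _ _) (cong (∑[ x ∈ xs ] f x y +_) (∑-comm xs ys f))

∑-filter : {P : Pred A 0ℓ} (P? : Decidable P) (xs : List A) (c d : ℕ) →
           ∑[ x ∈ xs ] (c + indicator (does (P? x)) * d) ≡ length xs * c + length (filter P? xs) * d
∑-filter P? []       c d = refl
∑-filter P? (x ∷ xs) c d with does (P? x)
... | false = trans (cong (c + 0 +_) (∑-filter P? xs c d)) (regroup c (length xs * c) (length (filter P? xs) * d))
  where
  regroup : ∀ c a b → c + 0 + (a + b) ≡ c + a + b
  regroup = solve-∀
... | true  = trans (cong (c + (d + 0) +_) (∑-filter P? xs c d)) (regroup c d (length xs * c) (length (filter P? xs) * d))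
  where
  regroup : ∀ c d a b → c + (d + 0) + (a + b) ≡ c + a + (d + b)
  regroup = solve-∀

length-allStrings : ∀ R → length (allStrings R) ≡ 2 ^ R
length-allStrings zero    = refl
length-allStrings (suc R) = trans (length-pairs (allStrings R)) (cong (2 *_) (length-allStrings R))
  where
  length-pairs : (rs : List (Vec Bool R)) →
                 length (concatMap (λ r → (false ∷ᵥ r) ∷ (true ∷ᵥ r) ∷ []) rs) ≡ 2 * length rs
  length-pairs []       = refl
  length-pairs (r ∷ rs) = trans (cong (2 +_) (length-pairs rs)) (sym (*-distribˡ-+ 2 1 (length rs)))

∑-allStrings-const : ∀ R c → ∑[ r ∈ allStrings R ] c ≡ 2 ^ R * c
∑-allStrings-const R c = trans (∑-const (allStrings R) c) (cong (_* c) (length-allStrings R))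

∑-allStrings-suc : ∀ R (f : Vec Bool (suc R) → ℕ) →
                   ∑ (allStrings (suc R)) f ≡ ∑[ r ∈ allStrings R ] (f (false ∷ᵥ r) + f (true ∷ᵥ r))
∑-allStrings-suc R f = ∑-pairs (allStrings R)
  where
  ∑-pairs : (rs : List (Vec Bool R)) →
            ∑ (concatMap (λ r → (false ∷ᵥ r) ∷ (true ∷ᵥ r) ∷ []) rs) f
              ≡ ∑[ r ∈ rs ] (f (false ∷ᵥ r) + f (true ∷ᵥ r))
  ∑-pairs []       = refl
  ∑-pairs (r ∷ rs) = trans (cong (λ s → f (false ∷ᵥ r) + (f (true ∷ᵥ r) + s)) (∑-pairs rs))
                           (sym (+-assoc (f (false ∷ᵥ r)) (f (true ∷ᵥ r)) _))

∑-allStrings-++ : ∀ m n (f : Vec Bool (m + n) → ℕ) →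
                  ∑ (allStrings (m + n)) f ≡ ∑[ s ∈ allStrings m ] ∑[ r ∈ allStrings n ] f (s ++ᵥ r)
∑-allStrings-++ zero    n f = sym (+-identityʳ _)
∑-allStrings-++ (suc m) n f = begin
  ∑ (allStrings (suc m + n)) f
    ≡⟨ ∑-allStrings-suc (m + n) f ⟩
  ∑[ v ∈ allStrings (m + n) ] (f (false ∷ᵥ v) + f (true ∷ᵥ v))
    ≡⟨ ∑-allStrings-++ m n _ ⟩
  ∑[ s ∈ allStrings m ] ∑[ r ∈ allStrings n ] (f (false ∷ᵥ (s ++ᵥ r)) + f (true ∷ᵥ (s ++ᵥ r)))
    ≡⟨ ∑-cong (allStrings m) (λ s → ∑-distrib-+ (allStrings n) _ _) ⟩
  ∑[ s ∈ allStrings m ] (∑[ r ∈ allStrings n ] f (false ∷ᵥ (s ++ᵥ r))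
                         + ∑[ r ∈ allStrings n ] f (true ∷ᵥ (s ++ᵥ r)))
    ≡⟨ ∑-allStrings-suc m (λ s → ∑[ r ∈ allStrings n ] f (s ++ᵥ r)) ⟨
  ∑[ s ∈ allStrings (suc m) ] ∑[ r ∈ allStrings n ] f (s ++ᵥ r) ∎
  where open ≡-Reasoning

∑-allStrings-pairs : ∀ n (f : Vec Bool (suc n) → ℕ) c → (∀ r → f (false ∷ᵥ r) + f (true ∷ᵥ r) ≡ c) →
                     2 * ∑ (allStrings (suc n)) f ≡ 2 ^ suc n * c
∑-allStrings-pairs n f c pair = begin
  2 * ∑ (allStrings (suc n)) f                          ≡⟨ cong (2 *_) (∑-allStrings-suc n f) ⟩
  2 * ∑[ r ∈ allStrings n ] (f (false ∷ᵥ r) + f (true ∷ᵥ r)) ≡⟨ cong (2 *_) (∑-cong (allStrings n) pair) ⟩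
  2 * ∑[ r ∈ allStrings n ] c                           ≡⟨ cong (2 *_) (∑-allStrings-const n c) ⟩
  2 * (2 ^ n * c)                                       ≡⟨ *-assoc 2 (2 ^ n) c ⟨
  2 ^ suc n * c                                         ∎
  where open ≡-Reasoning

∑-allStrings-agree : ∀ n {i j : Fin n} → i ≢ j → (a b : ℕ) →
  2 * ∑[ s ∈ allStrings n ] (if lookup s i xor lookup s j then b else a) ≡ 2 ^ n * (a + b)
∑-allStrings-agree (suc n) {zero}  {zero}  i≢j a b = ⊥-elim (i≢j refl)
∑-allStrings-agree (suc n) {zero}  {suc j} i≢j a b =
  ∑-allStrings-pairs n _ (a + b) (λ r → split-first (lookup r j))
  where
  split-first : ∀ β → (if false xor β then b else a) + (if true xor β then b else a) ≡ a + b
  split-first false = refl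
  split-first true  = +-comm b a
∑-allStrings-agree (suc n) {suc i} {zero}  i≢j a b =
  ∑-allStrings-pairs n _ (a + b) (λ r → split-second (lookup r i))
  where
  split-second : ∀ β → (if β xor false then b else a) + (if β xor true then b else a) ≡ a + b
  split-second false = refl
  split-second true  = +-comm b a
∑-allStrings-agree (suc n) {suc i} {suc j} i≢j a b = begin
  2 * ∑ (allStrings (suc n)) g       ≡⟨ cong (2 *_) (∑-allStrings-suc n g) ⟩
  2 * ∑[ r ∈ allStrings n ] (g′ r + g′ r)   ≡⟨ cong (2 *_) (∑-distrib-+ (allStrings n) g′ g′) ⟩
  2 * (∑ (allStrings n) g′ + ∑ (allStrings n) g′)
    ≡⟨ cong (λ s → 2 * (∑ (allStrings n) g′ + s)) (+-identityʳ _) ⟨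
  2 * (2 * ∑ (allStrings n) g′)     ≡⟨ cong (2 *_) (∑-allStrings-agree n (λ i≡j → i≢j (cong suc i≡j)) a b) ⟩
  2 * (2 ^ n * (a + b))              ≡⟨ *-assoc 2 (2 ^ n) (a + b) ⟨
  2 ^ suc n * (a + b)                ∎
  where
  open ≡-Reasoning
  g : Vec Bool (suc n) → ℕ
  g s = if lookup s (suc i) xor lookup s (suc j) then b else a
  g′ : Vec Bool n → ℕ
  g′ s = if lookup s i xor lookup s j then b else a

∑ˢ : Subset n → (Fin n → ℕ) → ℕ
∑ˢ []ᵥ          f = 0
∑ˢ (true  ∷ᵥ X) f = f zero + ∑ˢ X (λ x → f (suc x))
∑ˢ (false ∷ᵥ X) f = ∑ˢ X (λ x → f (suc x))

syntax ∑ˢ X (λ x → e) = ∑ˢ[ x ∈ X ] e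

∑ˢ-mono-≤ : (X : Subset n) {f g : Fin n → ℕ} → (∀ x → f x ≤ g x) → ∑ˢ X f ≤ ∑ˢ X g
∑ˢ-mono-≤ []ᵥ          le = z≤n
∑ˢ-mono-≤ (true  ∷ᵥ X) le = +-mono-≤ (le zero) (∑ˢ-mono-≤ X (λ x → le (suc x)))
∑ˢ-mono-≤ (false ∷ᵥ X) le = ∑ˢ-mono-≤ X (λ x → le (suc x))

∑ˢ-distrib-+ : (X : Subset n) (f g : Fin n → ℕ) → ∑ˢ[ x ∈ X ] (f x + g x) ≡ ∑ˢ X f + ∑ˢ X g
∑ˢ-distrib-+ []ᵥ          f g = refl
∑ˢ-distrib-+ (true  ∷ᵥ X) f g =
  trans (cong (f zero + g zero +_) (∑ˢ-distrib-+ X _ _)) (interchange (f zero) (g zero) _ _)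
∑ˢ-distrib-+ (false ∷ᵥ X) f g = ∑ˢ-distrib-+ X _ _

∑ˢ-*ˡ : (X : Subset n) (c : ℕ) (f : Fin n → ℕ) → ∑ˢ[ x ∈ X ] (c * f x) ≡ c * ∑ˢ X f
∑ˢ-*ˡ []ᵥ          c f = sym (*-zeroʳ c)
∑ˢ-*ˡ (true  ∷ᵥ X) c f = trans (cong (c * f zero +_) (∑ˢ-*ˡ X c _)) (sym (*-distribˡ-+ c (f zero) _))
∑ˢ-*ˡ (false ∷ᵥ X) c f = ∑ˢ-*ˡ X c _

∑ˢ-const : (X : Subset n) (c : ℕ) → ∑ˢ[ x ∈ X ] c ≡ ∣ X ∣ * c
∑ˢ-const []ᵥ          c = refl
∑ˢ-const (true  ∷ᵥ X) c = cong (c +_) (∑ˢ-const X c)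
∑ˢ-const (false ∷ᵥ X) c = ∑ˢ-const X c

term≤∑ˢ : {X : Subset n} (f : Fin n → ℕ) {x : Fin n} → x ∈ X → f x ≤ ∑ˢ X f
term≤∑ˢ                 f here        = m≤m+n (f zero) _
term≤∑ˢ {X = true  ∷ᵥ X} f (there x∈X) = ≤-trans (term≤∑ˢ (λ x → f (suc x)) x∈X) (m≤n+m _ (f zero))
term≤∑ˢ {X = false ∷ᵥ X} f (there x∈X) = term≤∑ˢ (λ x → f (suc x)) x∈X

∑-∑ˢ-comm : (rs : List A) (X : Subset n) (f : A → Fin n → ℕ) →
            ∑[ r ∈ rs ] ∑ˢ[ x ∈ X ] f r x ≡ ∑ˢ[ x ∈ X ] ∑[ r ∈ rs ] f r x
∑-∑ˢ-comm rs []ᵥ          f = trans (∑-const rs 0) (*-zeroʳ (length rs))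
∑-∑ˢ-comm rs (true  ∷ᵥ X) f = trans (∑-distrib-+ rs _ _) (cong (∑[ r ∈ rs ] f r zero +_) (∑-∑ˢ-comm rs X _))
∑-∑ˢ-comm rs (false ∷ᵥ X) f = ∑-∑ˢ-comm rs X _

∑ˢ-indicator : (X : Subset n) (y : Fin n) (c : ℕ) →
               ∑ˢ[ x ∈ X ] (indicator (does (x ≟ y)) * c) ≡ indicator (does (y ∈? X)) * c
∑ˢ-indicator (true  ∷ᵥ X) zero    c =
  trans (cong (c + 0 +_) (trans (∑ˢ-const X 0) (*-zeroʳ ∣ X ∣))) (+-identityʳ (c + 0))
∑ˢ-indicator (false ∷ᵥ X) zero    c = trans (∑ˢ-const X 0) (*-zeroʳ ∣ X ∣)
∑ˢ-indicator (true  ∷ᵥ X) (suc y) c = ∑ˢ-indicator X y c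
∑ˢ-indicator (false ∷ᵥ X) (suc y) c = ∑ˢ-indicator X y c

answer-yes : {X : Subset n} {y : Fin n} → y ∈ X → true ≡ ⌊ y ∈? X ⌋
answer-yes {X = X} {y} y∈X = sym (trans (isYes≗does (y ∈? X)) (dec-true (y ∈? X) y∈X))

answer-no : {X : Subset n} {y : Fin n} → y ∉ X → false ≡ ⌊ y ∈? X ⌋
answer-no {X = X} {y} y∉X = sym (trans (isYes≗does (y ∈? X)) (dec-false (y ∈? X) y∉X))

∣∣≡suc⇒nonempty : {X : Subset n} {k : ℕ} → ∣ X ∣ ≡ suc k → Nonempty X
∣∣≡suc⇒nonempty {n = n} {X = X} ∣X∣≡1+k with nonempty? X
... | yes nonempty = nonempty
... | no  empty    with trans (sym ∣X∣≡1+k) (trans (cong ∣_∣ (Empty-unique empty)) (∣⊥∣≡0 n))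
...   | ()

anyˢ : Subset n → (Fin n → Bool) → Bool
anyˢ []ᵥ          P = false
anyˢ (true  ∷ᵥ X) P = P zero ∨ anyˢ X (λ x → P (suc x))
anyˢ (false ∷ᵥ X) P = anyˢ X (λ x → P (suc x))

anyˢ-intro : {X : Subset n} (P : Fin n → Bool) {x : Fin n} → x ∈ X → P x ≡ true → anyˢ X P ≡ true
anyˢ-intro P here Px rewrite Px = refl
anyˢ-intro {X = true  ∷ᵥ X} P (there x∈X) Px with P zero
... | true  = refl
... | false = anyˢ-intro (λ x → P (suc x)) x∈X Px
anyˢ-intro {X = false ∷ᵥ X} P (there x∈X) Px = anyˢ-intro (λ x → P (suc x)) x∈X Px

anyˢ-elim : (X : Subset n) (P : Fin n → Bool) → anyˢ X P ≡ true → ∃ λ x → x ∈ X × P x ≡ true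
anyˢ-elim (true ∷ᵥ X) P any with P zero in Pz
... | true  = zero , here , Pz
... | false = let x , x∈X , Px = anyˢ-elim X _ any in suc x , there x∈X , Px
anyˢ-elim (false ∷ᵥ X) P any = let x , x∈X , Px = anyˢ-elim X _ any in suc x , there x∈X , Px

lcp : List Bool → List Bool → ℕ
lcp (a ∷ u) (b ∷ v) = if a xor b then 0 else suc (lcp u v)
lcp _       _       = 0

infix 4.5 _⊑ᵇ_
_⊑ᵇ_ : List Bool → List Bool → Bool
[]      ⊑ᵇ v       = true
(a ∷ u) ⊑ᵇ []      = false
(a ∷ u) ⊑ᵇ (b ∷ v) = if a xor b then false else u ⊑ᵇ v

bitAt : ℕ → List Bool → Bool
bitAt i       []      = false
bitAt zero    (b ∷ v) = b
bitAt (suc i) (b ∷ v) = bitAt i v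

lcp≤length : (u v : List Bool) → lcp u v ≤ length u
lcp≤length []      v       = z≤n
lcp≤length (a ∷ u) []      = z≤n
lcp≤length (a ∷ u) (b ∷ v) with a xor b
... | true  = z≤n
... | false = s≤s (lcp≤length u v)

lcp-self : (u : List Bool) → lcp u u ≡ length u
lcp-self []      = refl
lcp-self (a ∷ u) rewrite xor-same a = cong suc (lcp-self u)

lcp-full⇒≡ : (u v : List Bool) → length u ≡ length v → length u ≤ lcp u v → u ≡ v
lcp-full⇒≡ []      []      _   _ = refl
lcp-full⇒≡ (a ∷ u) (b ∷ v) len full with a | b
... | false | false = cong (false ∷_) (lcp-full⇒≡ u v (suc-injective len) (s≤s⁻¹ full))
... | true  | true  = cong (true ∷_)  (lcp-full⇒≡ u v (suc-injective len) (s≤s⁻¹ full))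

take-⊑ᵇ : ∀ j (u v : List Bool) → j ≤ lcp u v → take j v ⊑ᵇ u ≡ true
take-⊑ᵇ zero    u       v       j≤ = refl
take-⊑ᵇ (suc j) (a ∷ u) (b ∷ v) j≤ with a | b
... | false | false = take-⊑ᵇ j u v (s≤s⁻¹ j≤)
... | true  | true  = take-⊑ᵇ j u v (s≤s⁻¹ j≤)

⊑ᵇ-take : ∀ j (u v : List Bool) → take j v ⊑ᵇ u ≡ true → j ≤ length v → j ≤ lcp u v
⊑ᵇ-take zero    u       v       _   _  = z≤n
⊑ᵇ-take (suc j) (a ∷ u) (b ∷ v) pre j≤ with a | b
... | false | false = s≤s (⊑ᵇ-take j u v pre (s≤s⁻¹ j≤))
... | true  | true  = s≤s (⊑ᵇ-take j u v pre (s≤s⁻¹ j≤))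

⊑ᵇ-++⁻ : (u w s : List Bool) → u ++ w ⊑ᵇ s ≡ true → u ⊑ᵇ s ≡ true
⊑ᵇ-++⁻ []      w s       pre = refl
⊑ᵇ-++⁻ (a ∷ u) w (b ∷ s) pre with a xor b
... | false = ⊑ᵇ-++⁻ u w s pre

++-cancelˡ-≡length : (u u′ : List A) {v v′ : List A} → length u ≡ length u′ → u ++ v ≡ u′ ++ v′ → v ≡ v′
++-cancelˡ-≡length []      []       _   eq = eq
++-cancelˡ-≡length (b ∷ u) (b′ ∷ u′) len eq = ++-cancelˡ-≡length u u′ (suc-injective len) (∷-injectiveʳ eq)

take-++-bitAt : ∀ j (v : List Bool) → j < length v → take j v ++ [ bitAt j v ] ≡ take (suc j) v
take-++-bitAt zero    (b ∷ v) _   = refl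
take-++-bitAt (suc j) (b ∷ v) j<v = cong (b ∷_) (take-++-bitAt j v (s≤s⁻¹ j<v))

-- Random hashing: the hash of x starts with column x of a random M × n bit matrix

column : ∀ M → Vec Bool (M * n) → Fin n → List Bool
column             zero    r x = []
column {n = n} (suc M) r x = lookup (Vec.take n r) x ∷ column M (Vec.drop n r) x

length-column : ∀ M (r : Vec Bool (M * n)) x → length (column M r x) ≡ M
length-column zero    r x = refl
length-column (suc M) r x = cong suc (length-column M _ x)

column-suc : ∀ M (s : Vec Bool n) (r : Vec Bool (M * n)) x →
             column (suc M) (s ++ᵥ r) x ≡ lookup s x ∷ column M r x
column-suc M s r x = cong₂ (λ s′ r′ → lookup s′ x ∷ column M r′ x) (take-++ s r) (drop-++ s r)
  where
  take-++ : ∀ {m k} (s : Vec Bool m) (r : Vec Bool k) → Vec.take m (s ++ᵥ r) ≡ s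
  take-++ []ᵥ      r = refl
  take-++ (b ∷ᵥ s) r = cong (b ∷ᵥ_) (take-++ s r)
  drop-++ : ∀ {m k} (s : Vec Bool m) (r : Vec Bool k) → Vec.drop m (s ++ᵥ r) ≡ r
  drop-++ []ᵥ      r = refl
  drop-++ (b ∷ᵥ s) r = drop-++ s r

-- ifAbove q c l = (l + c if q ≤ l, else 0), written so that it commutes with shifting l and q.
ifAbove : ℕ → ℕ → ℕ → ℕ
ifAbove zero    c l       = l + c
ifAbove (suc q) c zero    = 0
ifAbove (suc q) c (suc l) = ifAbove q (suc c) l

ifAbove≤ : ∀ q c l → ifAbove q c l ≤ l + c
ifAbove≤ zero    c l       = ≤-refl
ifAbove≤ (suc q) c zero    = z≤n
ifAbove≤ (suc q) c (suc l) = ≤-trans (ifAbove≤ q (suc c) l) (≤-reflexive (+-suc l c))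

ifAbove-≥ : ∀ q c l → q ≤ l → ifAbove q c l ≡ l + c
ifAbove-≥ zero    c l       _   = refl
ifAbove-≥ (suc q) c (suc l) q≤l = trans (ifAbove-≥ q (suc c) l (s≤s⁻¹ q≤l)) (+-suc l c)

n<2^n : ∀ n → n < 2 ^ n
n<2^n zero    = s≤s z≤n
n<2^n (suc n) = ≤-trans (≤-reflexive (+-comm 1 (suc n)))
                        (+-mono-≤ (n<2^n n) (≤-trans (m^n>0 2 n) (≤-reflexive (sym (+-identityʳ _)))))

module Collision (tl : Fin n → List Bool) {x y : Fin n} (x≢y : x ≢ y) where

  hash : ∀ M → Vec Bool (M * n) → Fin n → List Bool
  hash M r z = column M r z ++ tl z

  -- 2 ^ (M * n) times the expectation of g (lcp (hash x) (hash y))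
  ∑lcp : ℕ → (ℕ → ℕ) → ℕ
  ∑lcp M g = ∑[ r ∈ allStrings (M * n) ] g (lcp (hash M r x) (hash M r y))

  T : ℕ
  T = lcp (tl x) (tl y)

  -- Row 0 of the matrix decides: the first bits differ with probability 1/2, else lcp drops by one.
  ∑lcp-suc : ∀ M g → 2 * ∑lcp (suc M) g ≡ 2 ^ n * (∑lcp M (λ l → g (suc l)) + 2 ^ (M * n) * g 0)
  ∑lcp-suc M g = begin
    2 * ∑lcp (suc M) g
      ≡⟨ cong (2 *_) (∑-allStrings-++ n (M * n) _) ⟩
    2 * ∑[ s ∈ allStrings n ] ∑[ r ∈ allStrings (M * n) ] g (lcp (hash (suc M) (s ++ᵥ r) x) (hash (suc M) (s ++ᵥ r) y))
      ≡⟨ cong (2 *_) (∑-cong (allStrings n) λ s →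
           trans (∑-cong (allStrings (M * n)) (first-bits s)) (∑-if (lookup s x xor lookup s y))) ⟩
    2 * ∑[ s ∈ allStrings n ] (if lookup s x xor lookup s y then ∑[ r ∈ allStrings (M * n) ] g 0
                                                          else ∑lcp M (λ l → g (suc l)))
      ≡⟨ ∑-allStrings-agree n x≢y _ _ ⟩
    2 ^ n * (∑lcp M (λ l → g (suc l)) + ∑[ r ∈ allStrings (M * n) ] g 0)
      ≡⟨ cong (λ z → 2 ^ n * (∑lcp M (λ l → g (suc l)) + z)) (∑-allStrings-const (M * n) (g 0)) ⟩
    2 ^ n * (∑lcp M (λ l → g (suc l)) + 2 ^ (M * n) * g 0) ∎
    where
    open ≡-Reasoning
    first-bits : ∀ s r → g (lcp (hash (suc M) (s ++ᵥ r) x) (hash (suc M) (s ++ᵥ r) y))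
                         ≡ (if lookup s x xor lookup s y then g 0 else g (suc (lcp (hash M r x) (hash M r y))))
    first-bits s r = trans (cong₂ (λ u v → g (lcp (u ++ tl x) (v ++ tl y))) (column-suc M s r x) (column-suc M s r y))
                           (if-float g (lookup s x xor lookup s y))
    ∑-if : ∀ b {f h : Vec Bool (M * n) → ℕ} →
           ∑[ r ∈ allStrings (M * n) ] (if b then f r else h r)
           ≡ (if b then ∑ (allStrings (M * n)) f else ∑ (allStrings (M * n)) h)
    ∑-if true  = refl
    ∑-if false = refl

  ∑lcp-suc-scaled : ∀ M g → 2 ^ suc M * ∑lcp (suc M) g
                            ≡ 2 ^ n * (2 ^ M * ∑lcp M (λ l → g (suc l)) + 2 ^ M * 2 ^ (M * n) * g 0)
  ∑lcp-suc-scaled M g = begin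
    2 ^ suc M * ∑lcp (suc M) g                                   ≡⟨ rearrange (2 ^ M) _ ⟩
    2 ^ M * (2 * ∑lcp (suc M) g)                                 ≡⟨ cong (2 ^ M *_) (∑lcp-suc M g) ⟩
    2 ^ M * (2 ^ n * (∑lcp M (λ l → g (suc l)) + 2 ^ (M * n) * g 0)) ≡⟨ distribute (2 ^ M) (2 ^ n) _ (2 ^ (M * n)) (g 0) ⟩
    2 ^ n * (2 ^ M * ∑lcp M (λ l → g (suc l)) + 2 ^ M * 2 ^ (M * n) * g 0) ∎
    where
    open ≡-Reasoning
    rearrange : ∀ m f → 2 * m * f ≡ m * (2 * f)
    rearrange = solve-∀
    distribute : ∀ m a f b h → m * (a * (f + b * h)) ≡ a * (m * f + m * b * h)
    distribute = solve-∀

  ∑lcp-+ : ∀ M c → 2 ^ M * ∑lcp M (λ l → l + c) ≤ 2 ^ (M * n) * (2 ^ M * (c + 1) + T)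
  ∑lcp-+ zero    c = ≤-trans (n≤1+n _) (≤-reflexive (shuffle T c))
    where
    shuffle : ∀ t c → suc (1 * (t + c + 0)) ≡ 1 * (1 * (c + 1) + t)
    shuffle = solve-∀
  ∑lcp-+ (suc M) c = begin
    2 ^ suc M * ∑lcp (suc M) (λ l → l + c)
      ≡⟨ ∑lcp-suc-scaled M (λ l → l + c) ⟩
    2 ^ n * (2 ^ M * ∑lcp M (λ l → suc l + c) + 2 ^ M * 2 ^ (M * n) * c)
      ≡⟨ cong (λ z → 2 ^ n * (2 ^ M * z + 2 ^ M * 2 ^ (M * n) * c))
              (∑-cong (allStrings (M * n)) (λ _ → sym (+-suc _ c))) ⟩
    2 ^ n * (2 ^ M * ∑lcp M (λ l → l + suc c) + 2 ^ M * 2 ^ (M * n) * c)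
      ≤⟨ *-monoʳ-≤ (2 ^ n) (+-monoˡ-≤ _ (∑lcp-+ M (suc c))) ⟩
    2 ^ n * (2 ^ (M * n) * (2 ^ M * (suc c + 1) + T) + 2 ^ M * 2 ^ (M * n) * c)
      ≡⟨ collect (2 ^ n) (2 ^ (M * n)) (2 ^ M) c T ⟩
    2 ^ n * 2 ^ (M * n) * (2 ^ suc M * (c + 1) + T)
      ≡⟨ cong (_* (2 ^ suc M * (c + 1) + T)) (^-distribˡ-+-* 2 n (M * n)) ⟨
    2 ^ (suc M * n) * (2 ^ suc M * (c + 1) + T) ∎
    where
    open ≤-Reasoning
    collect : ∀ a b m c t → a * (b * (m * (suc c + 1) + t) + m * b * c) ≡ a * b * (2 * m * (c + 1) + t)
    collect = solve-∀

  ∑lcp-ifAbove : ∀ q M c → 2 ^ (q + M) * ∑lcp (q + M) (ifAbove q c)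
                           ≤ 2 ^ ((q + M) * n) * (2 ^ M * (c + q + 1) + T)
  ∑lcp-ifAbove zero    M c rewrite +-identityʳ c = ∑lcp-+ M c
  ∑lcp-ifAbove (suc q) M c = begin
    2 ^ suc (q + M) * ∑lcp (suc (q + M)) (ifAbove (suc q) c)
      ≡⟨ ∑lcp-suc-scaled (q + M) (ifAbove (suc q) c) ⟩
    2 ^ n * (2 ^ (q + M) * ∑lcp (q + M) (ifAbove q (suc c)) + 2 ^ (q + M) * 2 ^ ((q + M) * n) * 0)
      ≡⟨ cong (λ z → 2 ^ n * (2 ^ (q + M) * ∑lcp (q + M) (ifAbove q (suc c)) + z))
                 (*-zeroʳ (2 ^ (q + M) * 2 ^ ((q + M) * n))) ⟩
    2 ^ n * (2 ^ (q + M) * ∑lcp (q + M) (ifAbove q (suc c)) + 0)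
      ≤⟨ *-monoʳ-≤ (2 ^ n) (+-monoˡ-≤ 0 (∑lcp-ifAbove q M (suc c))) ⟩
    2 ^ n * (2 ^ ((q + M) * n) * (2 ^ M * (suc c + q + 1) + T) + 0)
      ≡⟨ collect (2 ^ n) (2 ^ ((q + M) * n)) (2 ^ M) c q T ⟩
    2 ^ n * 2 ^ ((q + M) * n) * (2 ^ M * (c + suc q + 1) + T)
      ≡⟨ cong (_* (2 ^ M * (c + suc q + 1) + T)) (^-distribˡ-+-* 2 n ((q + M) * n)) ⟨
    2 ^ (suc (q + M) * n) * (2 ^ M * (c + suc q + 1) + T) ∎
    where
    open ≤-Reasoning
    collect : ∀ a b m c q t → a * (b * (m * (suc c + q + 1) + t) + 0) ≡ a * b * (m * (c + suc q + 1) + t)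
    collect = solve-∀

  ∑lcp-ifAbove-≤ : ∀ p B c → T ≤ B → 2 ^ p * ∑lcp (p + B) (ifAbove p c) ≤ 2 ^ ((p + B) * n) * (c + p + 2)
  ∑lcp-ifAbove-≤ p B c T≤B = *-cancelˡ-≤ (2 ^ B) {{m^n≢0 2 B}} (begin
    2 ^ B * (2 ^ p * F)           ≡⟨ *-assoc (2 ^ B) (2 ^ p) F ⟨
    2 ^ B * 2 ^ p * F             ≡⟨ cong (_* F) (trans (*-comm (2 ^ B) (2 ^ p)) (sym (^-distribˡ-+-* 2 p B))) ⟩
    2 ^ (p + B) * F               ≤⟨ ∑lcp-ifAbove p B c ⟩
    Q * (2 ^ B * (c + p + 1) + T) ≤⟨ *-monoʳ-≤ Q (+-monoʳ-≤ (2 ^ B * (c + p + 1)) (≤-trans T≤B (<⇒≤ (n<2^n B)))) ⟩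
    Q * (2 ^ B * (c + p + 1) + 2 ^ B) ≡⟨ collect Q (2 ^ B) (c + p) ⟩
    2 ^ B * (Q * (c + p + 2))     ∎)
    where
    open ≤-Reasoning
    F = ∑lcp (p + B) (ifAbove p c)
    Q = 2 ^ ((p + B) * n)
    collect : ∀ q b a → q * (b * (a + 1) + b) ≡ b * (q * (a + 2))
    collect = solve-∀

-- Alice's first message: the binary trie of the p-bit prefixes of the hashes of X

module Trie {n : ℕ} (H : Fin n → List Bool) where

  occupied : List Bool → Subset n → Bool
  occupied π X = anyˢ X (λ x → π ⊑ᵇ H x)

  -- Each occupied node of depth < d contributes two bits, telling which of its children are occupied.
  trie : ℕ → List Bool → Subset n → List Bool
  trie zero    π X = []
  trie (suc d) π X =
    occupied (π ∷ʳ false) X ∷ occupied (π ∷ʳ true) X ∷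
    (if occupied (π ∷ʳ false) X then trie d (π ∷ʳ false) X else []) ++
    (if occupied (π ∷ʳ true)  X then trie d (π ∷ʳ true)  X else [])

  skipTrie : ℕ → List Bool → List Bool
  skipTrie zero    ts               = ts
  skipTrie (suc d) (b₀ ∷ b₁ ∷ ts) = if b₁ then skipTrie d ts₁ else ts₁
    where ts₁ = if b₀ then skipTrie d ts else ts
  skipTrie (suc d) _                = []

  inTrie : ℕ → List Bool → List Bool → Bool
  inTrie zero    ts               q           = true
  inTrie (suc d) (b₀ ∷ b₁ ∷ ts) (false ∷ q) = b₀ ∧ inTrie d ts q
  inTrie (suc d) (b₀ ∷ b₁ ∷ ts) (true  ∷ q) = b₁ ∧ inTrie d (if b₀ then skipTrie d ts else ts) q
  inTrie (suc d) _                _           = false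

  occupied-++⁻ : ∀ π w X → occupied (π ++ w) X ≡ true → occupied π X ≡ true
  occupied-++⁻ π w X occ =
    let x , x∈X , pre = anyˢ-elim X _ occ in anyˢ-intro _ x∈X (⊑ᵇ-++⁻ π w (H x) pre)

  unoccupied-++ : ∀ π w X → occupied π X ≡ false → occupied (π ++ w) X ≡ false
  unoccupied-++ π w X unocc with occupied (π ++ w) X in occ
  ... | false = refl
  ... | true  = trans (sym (occupied-++⁻ π w X occ)) unocc

  skipTrie-trie : ∀ d π X rest → skipTrie d (trie d π X ++ rest) ≡ rest
  skipTrie-trie zero    π X rest = refl
  skipTrie-trie (suc d) π X rest with occupied (π ∷ʳ false) X | occupied (π ∷ʳ true) X
  ... | false | false = refl
  ... | false | true  = skipTrie-trie d (π ∷ʳ true) X rest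
  ... | true  | false = trans (cong (skipTrie d) (++-assoc (trie d (π ∷ʳ false) X) [] rest))
                              (skipTrie-trie d (π ∷ʳ false) X rest)
  ... | true  | true
    rewrite ++-assoc (trie d (π ∷ʳ false) X) (trie d (π ∷ʳ true) X) rest
          | skipTrie-trie d (π ∷ʳ false) X (trie d (π ∷ʳ true) X ++ rest)
          = skipTrie-trie d (π ∷ʳ true) X rest

  inTrie-trie : ∀ d π X rest q → occupied π X ≡ true → d ≤ length q →
                inTrie d (trie d π X ++ rest) q ≡ occupied (π ++ take d q) X
  inTrie-trie zero    π X rest q occ _ = trans (sym occ) (cong (λ π′ → occupied π′ X) (sym (++-identityʳ π)))
  inTrie-trie (suc d) π X rest (b ∷ q) occ d≤q = descend b
    where
    below : ∀ b → occupied ((π ∷ʳ b) ++ take d q) X ≡ occupied (π ++ take (suc d) (b ∷ q)) X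
    below b = cong (λ π′ → occupied π′ X) (++-assoc π [ b ] (take d q))
    child : ∀ b rest → occupied (π ∷ʳ b) X ≡ true →
            inTrie d (trie d (π ∷ʳ b) X ++ rest) q ≡ occupied (π ++ take (suc d) (b ∷ q)) X
    child b rest occ′ = trans (inTrie-trie d (π ∷ʳ b) X rest q occ′ (s≤s⁻¹ d≤q)) (below b)
    absent : ∀ b → occupied (π ∷ʳ b) X ≡ false → false ≡ occupied (π ++ take (suc d) (b ∷ q)) X
    absent b unocc = sym (trans (sym (below b)) (unoccupied-++ (π ∷ʳ b) (take d q) X unocc))
    descend : ∀ b → inTrie (suc d) (trie (suc d) π X ++ rest) (b ∷ q) ≡ occupied (π ++ take (suc d) (b ∷ q)) X
    descend false with occupied (π ∷ʳ false) X in occ₀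
    ... | false = absent false occ₀
    ... | true  = trans (cong (λ ts → inTrie d ts q) (++-assoc (trie d (π ∷ʳ false) X) _ rest)) (child false _ occ₀)
    descend true with occupied (π ∷ʳ false) X | occupied (π ∷ʳ true) X in occ₁
    ... | _     | false = absent true occ₁
    ... | false | true  = child true rest occ₁
    ... | true  | true  = trans (cong (λ ts → inTrie d (skipTrie d ts) q) (++-assoc (trie d (π ∷ʳ false) X) _ rest))
                                (trans (cong (λ ts → inTrie d ts q) (skipTrie-trie d (π ∷ʳ false) X _))
                                       (child true rest occ₁))

  population : List Bool → Subset n → ℕ
  population π X = ∑ˢ[ x ∈ X ] indicator (π ⊑ᵇ H x)

  population-pos : ∀ π X → occupied π X ≡ true → 1 ≤ population π X
  population-pos π X occ =
    let x , x∈X , pre = anyˢ-elim X _ occ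
    in ≤-trans (≤-reflexive (cong indicator (sym pre))) (term≤∑ˢ (λ x → indicator (π ⊑ᵇ H x)) x∈X)

  population-children : ∀ π X → population (π ∷ʳ false) X + population (π ∷ʳ true) X ≤ population π X
  population-children π X =
    ≤-trans (≤-reflexive (sym (∑ˢ-distrib-+ X _ _))) (∑ˢ-mono-≤ X (λ x → children π (H x)))
    where
    children : ∀ π s → indicator (π ∷ʳ false ⊑ᵇ s) + indicator (π ∷ʳ true ⊑ᵇ s) ≤ indicator (π ⊑ᵇ s)
    children []      []          = z≤n
    children []      (false ∷ s) = ≤-refl
    children []      (true  ∷ s) = ≤-refl
    children (a ∷ π) []          = z≤n
    children (a ∷ π) (b ∷ s) with a xor b
    ... | true  = z≤n
    ... | false = children π s

  -- With j free: levels below j have at most 2 ^ level nodes, deeper ones at most population π X.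
  length-trie : ∀ d π X → occupied π X ≡ true → ∀ j →
                length (trie d π X) + 2 ≤ 2 * (2 ^ j + (d ∸ j) * population π X)
  length-trie zero    π X occ j = *-monoʳ-≤ 2 (≤-trans (m^n>0 2 j) (m≤m+n _ _))
  length-trie (suc d) π X occ j = ≤-trans (≤-reflexive split) (level j)
    where
    subtrie : Bool → List Bool
    subtrie b = if occupied (π ∷ʳ b) X then trie d (π ∷ʳ b) X else []
    P = population π X
    p₀ = population (π ∷ʳ false) X
    p₁ = population (π ∷ʳ true) X
    split : length (trie (suc d) π X) + 2 ≡ (length (subtrie false) + 2) + (length (subtrie true) + 2)
    split = trans (cong (λ l → suc (suc l) + 2) (length-++ (subtrie false)))
                  (regroup (length (subtrie false)) (length (subtrie true)))
      where
      regroup : ∀ a b → suc (suc (a + b)) + 2 ≡ (a + 2) + (b + 2)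
      regroup = solve-∀
    child : ∀ b j → length (subtrie b) + 2 ≤ 2 * (2 ^ j + (d ∸ j) * population (π ∷ʳ b) X)
    child b j with occupied (π ∷ʳ b) X in occ′
    ... | true  = length-trie d (π ∷ʳ b) X occ′ j
    ... | false = *-monoʳ-≤ 2 (≤-trans (m^n>0 2 j) (m≤m+n _ _))
    level : ∀ j → (length (subtrie false) + 2) + (length (subtrie true) + 2) ≤ 2 * (2 ^ j + (suc d ∸ j) * P)
    level zero = begin
      (length (subtrie false) + 2) + (length (subtrie true) + 2) ≤⟨ +-mono-≤ (child false 0) (child true 0) ⟩
      2 * (1 + d * p₀) + 2 * (1 + d * p₁)                         ≡⟨ regroup d p₀ p₁ ⟩
      2 + 2 + 2 * (d * (p₀ + p₁))
        ≤⟨ +-mono-≤ (+-monoʳ-≤ 2 (*-monoʳ-≤ 2 (population-pos π X occ)))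
                    (*-monoʳ-≤ 2 (*-monoʳ-≤ d (population-children π X))) ⟩
      2 + 2 * P + 2 * (d * P)                                     ≡⟨ regroup′ d P ⟩
      2 * (1 + suc d * P)                                         ∎
      where
      open ≤-Reasoning
      regroup : ∀ d a b → 2 * (1 + d * a) + 2 * (1 + d * b) ≡ 2 + 2 + 2 * (d * (a + b))
      regroup = solve-∀
      regroup′ : ∀ d p → 2 + 2 * p + 2 * (d * p) ≡ 2 * (1 + suc d * p)
      regroup′ = solve-∀
    level (suc j) = begin
      (length (subtrie false) + 2) + (length (subtrie true) + 2) ≤⟨ +-mono-≤ (child false j) (child true j) ⟩
      2 * (2 ^ j + (d ∸ j) * p₀) + 2 * (2 ^ j + (d ∸ j) * p₁)   ≡⟨ regroup (2 ^ j) (d ∸ j) p₀ p₁ ⟩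
      2 * (2 ^ suc j + (d ∸ j) * (p₀ + p₁))
        ≤⟨ *-monoʳ-≤ 2 (+-monoʳ-≤ (2 ^ suc j) (*-monoʳ-≤ (d ∸ j) (population-children π X))) ⟩
      2 * (2 ^ suc j + (d ∸ j) * P)                               ∎
      where
      open ≤-Reasoning
      regroup : ∀ a e x y → 2 * (a + e * x) + 2 * (a + e * y) ≡ 2 * (2 * a + e * (x + y))
      regroup = solve-∀

-- The protocol, for a fixed hash H whose p-bit prefixes go into the trie and whose length is L

module Protocol {n : ℕ} (p L : ℕ) (H : Fin n → List Bool) where

  open Trie H public

  Stage : Set
  Stage = Tree (Subset n) (Fin n)

  sendTrie : ℕ → List Bool → (List Bool → Stage) → Stage
  sendTrie zero    π κ = κ []
  sendTrie (suc d) π κ =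
    alice (occupied (π ∷ʳ false)) λ b₀ →
    alice (occupied (π ∷ʳ true)) λ b₁ →
    (if b₀ then sendTrie d (π ∷ʳ false) else λ κ′ → κ′ []) λ t₀ →
    (if b₁ then sendTrie d (π ∷ʳ true)  else λ κ′ → κ′ []) λ t₁ →
    κ (b₀ ∷ b₁ ∷ t₀ ++ t₁)

  run-sendTrie : ∀ d π κ X y → run (sendTrie d π κ) X y ≡
                 (trie d π X ++ proj₁ (run (κ (trie d π X)) X y) , proj₂ (run (κ (trie d π X)) X y))
  run-sendTrie zero    π κ X y = refl
  run-sendTrie (suc d) π κ X y with occupied (π ∷ʳ false) X | occupied (π ∷ʳ true) X
  ... | false | false = refl
  ... | true  | false
    rewrite run-sendTrie d (π ∷ʳ false) (λ t₀ → κ (true ∷ false ∷ t₀ ++ [])) X y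
          | ++-identityʳ (trie d (π ∷ʳ false) X) = refl
  ... | false | true
    rewrite run-sendTrie d (π ∷ʳ true) (λ t₁ → κ (false ∷ true ∷ t₁)) X y = refl
  ... | true  | true
    rewrite run-sendTrie d (π ∷ʳ false) (λ t₀ → sendTrie d (π ∷ʳ true) (λ t₁ → κ (true ∷ true ∷ t₀ ++ t₁))) X y
          | run-sendTrie d (π ∷ʳ true) (λ t₁ → κ (true ∷ true ∷ trie d (π ∷ʳ false) X ++ t₁)) X y
          | ++-assoc (trie d (π ∷ʳ false) X) (trie d (π ∷ʳ true) X)
                     (proj₁ (run (κ (true ∷ true ∷ trie d (π ∷ʳ false) X ++ trie d (π ∷ʳ true) X)) X y))
          = refl

  escalate : ℕ → List Bool → Stage
  escalate zero    q = out (λ _ → true)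
  escalate (suc m) q =
    bob (λ y → bitAt (length q) (H y)) λ b →
    alice (occupied (q ∷ʳ b)) λ c →
    if c then escalate m (q ∷ʳ b) else out (λ _ → false)

  query : List Bool → Stage
  query t = bob (λ y → inTrie p t (H y)) λ b → if b then escalate L [] else out (λ _ → false)

  -- The first transcript of the history starts with the trie.
  protocol : History n → Stage
  protocol []            = sendTrie p [] query
  protocol ((_ , t) ∷ _) = query t

  module Analysis (length-H : ∀ x → length (H x) ≡ L) (H-injective : ∀ x y → H x ≡ H y → x ≡ y)
                  (p≤L : p ≤ L) where

    ℓ : Fin n → Fin n → ℕ
    ℓ x y = lcp (H x) (H y)

    EscalationResult : Subset n → Fin n → ℕ → List Bool × Bool → Set
    EscalationResult X y j (t , o) =
      o ≡ ⌊ y ∈? X ⌋ × ∃ λ x → x ∈ X × length t + 2 * j ≤ 2 * (ℓ x y + 1)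

    j<length-H : ∀ y {j m} → j + suc m ≡ L → j < length (H y)
    j<length-H y {j} {m} j+m≡L = subst (j <_) (trans j+m≡L (sym (length-H y))) (m<m+n j (s≤s z≤n))

    next-prefix : ∀ y {j} q → q ≡ take j (H y) → j < length (H y) →
                  q ∷ʳ bitAt (length q) (H y) ≡ take (suc j) (H y)
    next-prefix y {j} q refl j<H =
      trans (cong (λ i → take j (H y) ∷ʳ bitAt i (H y)) (trans (length-take j (H y)) (m≤n⇒m⊓n≡m (<⇒≤ j<H))))
            (take-++-bitAt j (H y) j<H)

    run-escalate : ∀ X y m j q → q ≡ take j (H y) → j + m ≡ L → ∀ {x₁} → x₁ ∈ X → j ≤ ℓ x₁ y →
                   EscalationResult X y j (run (escalate m q) X y)
    run-escalate X y zero j q _ j+0≡L {x₁} x₁∈X j≤ℓ =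
      answer-yes (subst (_∈ X) (H-injective x₁ y Hx₁≡Hy) x₁∈X) ,
      x₁ , x₁∈X , *-monoʳ-≤ 2 (≤-trans j≤ℓ (m≤m+n _ 1))
      where
      Hx₁≡Hy : H x₁ ≡ H y
      Hx₁≡Hy = lcp-full⇒≡ (H x₁) (H y) (trans (length-H x₁) (sym (length-H y)))
                 (subst (_≤ ℓ x₁ y) (trans (sym (+-identityʳ j)) (trans j+0≡L (sym (length-H x₁)))) j≤ℓ)
    run-escalate X y (suc m) j q q≡ j+m≡L {x₁} x₁∈X j≤ℓ
      with bitAt (length q) (H y) | next-prefix y q q≡ (j<length-H y j+m≡L)
    ... | b | extended with occupied (q ∷ʳ b) X in occ
    ...   | false =
      answer-no y∉X , x₁ , x₁∈X , ≤-trans (≤-reflexive (double-suc j)) (*-monoʳ-≤ 2 (+-monoˡ-≤ 1 j≤ℓ))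
      where
      double-suc : ∀ j → 2 + 2 * j ≡ 2 * (j + 1)
      double-suc = solve-∀
      y-extended : q ∷ʳ b ⊑ᵇ H y ≡ true
      y-extended = subst (λ π → π ⊑ᵇ H y ≡ true) (sym extended)
                     (take-⊑ᵇ (suc j) (H y) (H y) (subst (suc j ≤_) (sym (lcp-self (H y))) (j<length-H y j+m≡L)))
      y∉X : y ∉ X
      y∉X y∈X with trans (sym (anyˢ-intro _ y∈X y-extended)) occ
      ... | ()
    ...   | true with anyˢ-elim X _ occ
    ...     | x′ , x′∈X , pre
      with run-escalate X y m (suc j) (q ∷ʳ b) extended (trans (sym (+-suc j m)) j+m≡L) x′∈X
             (⊑ᵇ-take (suc j) (H x′) (H y) (subst (λ π → π ⊑ᵇ H x′ ≡ true) extended pre) (j<length-H y j+m≡L))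
    ...       | correct , x₂ , x₂∈X , cost = correct , x₂ , x₂∈X , ≤-trans (≤-reflexive (shift _ j)) cost
      where
      shift : ∀ t j → suc (suc t) + 2 * j ≡ t + 2 * suc j
      shift = solve-∀

    stageCost : Subset n → Fin n → ℕ
    stageCost X y = 1 + ∑ˢ[ x ∈ X ] (2 * ifAbove p 1 (ℓ x y))

    deep-term≤∑ˢ : ∀ X y {x} → x ∈ X → p ≤ ℓ x y →
                   2 * (ℓ x y + 1) ≤ ∑ˢ[ x ∈ X ] (2 * ifAbove p 1 (ℓ x y))
    deep-term≤∑ˢ X y {x} x∈X p≤ℓ = ≤-trans (≤-reflexive (cong (2 *_) (sym (ifAbove-≥ p 1 (ℓ x y) p≤ℓ))))
                                         (term≤∑ˢ (λ x → 2 * ifAbove p 1 (ℓ x y)) x∈X)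

    -- Escalation only starts once some x₀ ∈ X shares p bits with y,
    -- so its cost is paid by an x with ℓ x y ≥ p.
    escalation≤∑ˢ : ∀ X y {x₀ x₂} → x₀ ∈ X → p ≤ ℓ x₀ y → x₂ ∈ X → ∀ {c} → c ≤ 2 * (ℓ x₂ y + 1) →
                    c ≤ ∑ˢ[ x ∈ X ] (2 * ifAbove p 1 (ℓ x y))
    escalation≤∑ˢ X y {x₀} {x₂} x₀∈X p≤ℓ₀ x₂∈X c≤ with p ≤? ℓ x₂ y
    ... | yes p≤ℓ₂ = ≤-trans c≤ (deep-term≤∑ˢ X y x₂∈X p≤ℓ₂)
    ... | no  p≰ℓ₂ = ≤-trans c≤ (≤-trans (*-monoʳ-≤ 2 (+-monoˡ-≤ 1 (≤-trans (<⇒≤ (≰⇒> p≰ℓ₂)) p≤ℓ₀)))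
                                         (deep-term≤∑ˢ X y x₀∈X p≤ℓ₀))

    p≤length-H : ∀ y → p ≤ length (H y)
    p≤length-H y = subst (p ≤_) (sym (length-H y)) p≤L

    inTrie-hash : ∀ X y rest {x₀} → x₀ ∈ X → inTrie p (trie p [] X ++ rest) (H y) ≡ occupied (take p (H y)) X
    inTrie-hash X y rest x₀∈X = inTrie-trie p [] X rest (H y) (anyˢ-intro _ x₀∈X refl) (p≤length-H y)

    QueryResult : Subset n → Fin n → List Bool × Bool → Set
    QueryResult X y (t , o) = o ≡ ⌊ y ∈? X ⌋ × length t ≤ stageCost X y

    run-query : ∀ X y rest {x₀} → x₀ ∈ X → QueryResult X y (run (query (trie p [] X ++ rest)) X y)
    run-query X y rest {x₀} x₀∈X with inTrie p (trie p [] X ++ rest) (H y) in found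
    ... | false = answer-no y∉X , s≤s z≤n
      where
      y∉X : y ∉ X
      y∉X y∈X with trans (sym found) (trans (inTrie-hash X y rest x₀∈X)
                   (anyˢ-intro _ y∈X (take-⊑ᵇ p (H y) (H y) (subst (p ≤_) (sym (lcp-self (H y))) (p≤length-H y)))))
      ... | ()
    ... | true with anyˢ-elim X _ (trans (sym (inTrie-hash X y rest x₀∈X)) found)
    ...   | x₁ , x₁∈X , pre with run-escalate X y L 0 [] refl refl x₁∈X z≤n
    ...     | correct , x₂ , x₂∈X , cost =
              correct , s≤s (escalation≤∑ˢ X y x₁∈X (⊑ᵇ-take p (H x₁) (H y) pre (p≤length-H y)) x₂∈X
                                           (≤-trans (≤-reflexive (sym (+-identityʳ _))) cost))

    ExecResult : Subset n → List (Fin n) → ℕ → ℕ × List Bool → Set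
    ExecResult X ys base (c , os) = os ≡ map (λ y → ⌊ y ∈? X ⌋) ys × c ≤ base + ∑ ys (stageCost X)

    exec-queries : ∀ X {x₀} → x₀ ∈ X → ∀ y₁ rest h ys →
                   ExecResult X ys 0 (exec protocol X ((y₁ , trie p [] X ++ rest) ∷ h) ys)
    exec-queries X x₀∈X y₁ rest h []       = refl , z≤n
    exec-queries X x₀∈X y₁ rest h (y ∷ ys) =
      let correct , cost = run-query X y rest x₀∈X
          corrects , costs = exec-queries X x₀∈X y₁ rest (h ++ [ (y , proj₁ (run (query (trie p [] X ++ rest)) X y)) ]) ys
      in cong₂ _∷_ correct corrects , +-mono-≤ cost costs

    exec-protocol : ∀ X {x₀} → x₀ ∈ X → ∀ ys → ExecResult X ys (length (trie p [] X)) (exec protocol X [] ys)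
    exec-protocol X x₀∈X []       = refl , z≤n
    exec-protocol X x₀∈X (y ∷ ys) rewrite run-sendTrie p [] query X y =
      let correct , cost = subst (λ t → QueryResult X y (run (query t) X y)) (++-identityʳ (trie p [] X))
                                 (run-query X y [] x₀∈X)
          corrects , costs = exec-queries X x₀∈X y (proj₁ (run (query (trie p [] X)) X y)) [] ys
      in cong₂ _∷_ correct corrects , prefixed-cost (trie p [] X) _ cost costs
      where
      prefixed-cost : ∀ (τ t : List Bool) {c s r} → length t ≤ s → c ≤ 0 + r →
                      length (τ ++ t) + c ≤ length τ + (s + r)
      prefixed-cost τ t {c} t≤ c≤ = ≤-trans (≤-reflexive (trans (cong (_+ c) (length-++ τ)) (+-assoc (length τ) _ c)))
                                            (+-monoʳ-≤ (length τ) (+-mono-≤ t≤ c≤))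

2^⌊log₂⌋≤ : ∀ n → 1 ≤ n → 2 ^ ⌊log₂ n ⌋ ≤ n
2^⌊log₂⌋≤ (suc n) _ = go n (<-wellFounded (suc n))
  where
  go : ∀ n acc → 2 ^ ⌊log2⌋ (suc n) acc ≤ suc n
  go zero          _        = ≤-refl
  go (suc m) (acc rs) = begin
    2 * 2 ^ ⌊log2⌋ (suc ⌊ m /2⌋) _ ≤⟨ *-monoʳ-≤ 2 (go ⌊ m /2⌋ _) ⟩
    2 * suc ⌊ m /2⌋                ≡⟨ *-suc 2 ⌊ m /2⌋ ⟩
    2 + 2 * ⌊ m /2⌋                ≤⟨ +-monoʳ-≤ 2 (≤-trans (≤-reflexive (cong (⌊ m /2⌋ +_) (+-identityʳ _)))
                                                        (+-monoʳ-≤ ⌊ m /2⌋ (⌊n/2⌋≤⌈n/2⌉ m))) ⟩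
    2 + (⌊ m /2⌋ + ⌈ m /2⌉)        ≡⟨ cong (2 +_) (⌊n/2⌋+⌈n/2⌉≡n m) ⟩
    suc (suc m)                    ∎
    where open ≤-Reasoning

<2^suc⌊log₂⌋ : ∀ n → n < 2 ^ suc ⌊log₂ n ⌋
<2^suc⌊log₂⌋ n with n <? 2 ^ suc ⌊log₂ n ⌋
... | yes n< = n<
... | no  n≮ = ⊥-elim (<-irrefl refl (begin-strict
  ⌊log₂ n ⌋                     <⟨ n<1+n _ ⟩
  suc ⌊log₂ n ⌋                 ≡⟨ ⌊log₂[2^n]⌋≡n (suc ⌊log₂ n ⌋) ⟨
  ⌊log₂ 2 ^ suc ⌊log₂ n ⌋ ⌋     ≤⟨ ⌊log₂⌋-mono-≤ (≮⇒≥ n≮) ⟩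
  ⌊log₂ n ⌋                     ∎))
  where open ≤-Reasoning

⌊log₂⌋≤ : ∀ n → ⌊log₂ n ⌋ ≤ n
⌊log₂⌋≤ n = ≤-trans (⌊log₂⌋-mono-≤ (<⇒≤ (n<2^n n))) (≤-reflexive (⌊log₂[2^n]⌋≡n n))

-- Fixed-width binary numerals, least significant bit first

parity : ℕ → Bool
parity zero          = false
parity (suc zero)    = true
parity (suc (suc m)) = parity m

parity+2*half : ∀ m → indicator (parity m) + 2 * ⌊ m /2⌋ ≡ m
parity+2*half zero          = refl
parity+2*half (suc zero)    = refl
parity+2*half (suc (suc m)) = trans (shift (indicator (parity m)) ⌊ m /2⌋) (cong (2 +_) (parity+2*half m))
  where
  shift : ∀ a h → a + 2 * suc h ≡ 2 + (a + 2 * h)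
  shift = solve-∀

bits : ℕ → ℕ → List Bool
bits zero    m = []
bits (suc B) m = parity m ∷ bits B ⌊ m /2⌋

length-bits : ∀ B m → length (bits B m) ≡ B
length-bits zero    m = refl
length-bits (suc B) m = cong suc (length-bits B ⌊ m /2⌋)

bits-injective : ∀ B {m m′} → m < 2 ^ B → m′ < 2 ^ B → bits B m ≡ bits B m′ → m ≡ m′
bits-injective zero    {zero}  {zero}  _ _ _ = refl
bits-injective zero    {suc m} (s≤s ()) _
bits-injective zero    {m′ = suc m′} _ (s≤s ())
bits-injective (suc B) {m} {m′} m< m′< eq = begin
  m                                        ≡⟨ parity+2*half m ⟨
  indicator (parity m) + 2 * ⌊ m /2⌋       ≡⟨ cong₂ (λ b h → indicator b + 2 * h) (∷-injectiveˡ eq)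
                                                (bits-injective B (half< m m<) (half< m′ m′<) (∷-injectiveʳ eq)) ⟩
  indicator (parity m′) + 2 * ⌊ m′ /2⌋     ≡⟨ parity+2*half m′ ⟩
  m′                                       ∎
  where
  open ≡-Reasoning
  half< : ∀ m → m < 2 ^ suc B → ⌊ m /2⌋ < 2 ^ B
  half< m m< = *-cancelˡ-< 2 _ _
    (≤-trans (s≤s (≤-trans (m≤n+m _ (indicator (parity m))) (≤-reflexive (parity+2*half m)))) m<)

module Construction (n k : ℕ) where

  -- 2 ^ a > k, and the remaining t trie levels are what makes escalation unlikely.
  loglog a t p B M L R : ℕ
  loglog = ⌊log₂ ⌊log₂ k ⌋ ⌋
  a = suc ⌊log₂ k ⌋
  t = loglog + 6
  p = a + t
  B = suc ⌊log₂ n ⌋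
  M = p + B
  L = M + B
  R = M * n

  -- E bounds the length of the trie, D the escalation cost for an element of X.
  E D : ℕ
  E = 2 * (2 ^ a + t * k)
  D = 2 * (L + 1)

  hash : Vec Bool R → Fin n → List Bool
  hash r x = column M r x ++ bits B (toℕ x)

  length-hash : ∀ r x → length (hash r x) ≡ L
  length-hash r x = trans (length-++ (column M r x)) (cong₂ _+_ (length-column M r x) (length-bits B (toℕ x)))

  hash-injective : ∀ r x y → hash r x ≡ hash r y → x ≡ y
  hash-injective r x y eq = toℕ-injective (bits-injective B (toℕ<2^B x) (toℕ<2^B y)
                              (++-cancelˡ-≡length (column M r x) (column M r y)
                                 (trans (length-column M r x) (sym (length-column M r y))) eq))
    where
    toℕ<2^B : ∀ x → toℕ x < 2 ^ B
    toℕ<2^B x = <-≤-trans (toℕ<n x) (<⇒≤ (<2^suc⌊log₂⌋ n))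

  protocolₙₖ : Protocol n R
  protocolₙₖ r = Protocol.protocol p L (hash r)

  module Run (r : Vec Bool R) where
    open Protocol p L (hash r) public
    open Analysis (length-hash r) (hash-injective r) (≤-trans (m≤m+n p B) (m≤m+n M B)) public

  few-collisions : 2 * k * (p + 3) ≤ 2 ^ p
  few-collisions = begin
    2 * k * (p + 3)     ≡⟨ rearrange k (p + 3) ⟩
    k * (2 * (p + 3))   ≤⟨ *-mono-≤ (<⇒≤ (<2^suc⌊log₂⌋ k)) levels ⟩
    2 ^ a * 2 ^ t       ≡⟨ ^-distribˡ-+-* 2 a t ⟨
    2 ^ p               ∎
    where
    open ≤-Reasoning
    rearrange : ∀ k q → 2 * k * q ≡ k * (2 * q)
    rearrange = solve-∀
    Λ = 2 ^ loglog
    levels : 2 * (p + 3) ≤ 2 ^ t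
    levels = begin
      2 * (p + 3)                            ≡⟨ regroup ⌊log₂ k ⌋ loglog ⟩
      2 * (suc ⌊log₂ k ⌋ + loglog + 9 * 1)
        ≤⟨ *-monoʳ-≤ 2 (+-mono-≤ (+-mono-≤ (<2^suc⌊log₂⌋ ⌊log₂ k ⌋) (<⇒≤ (n<2^n loglog)))
                                 (*-monoʳ-≤ 9 (m^n>0 2 loglog))) ⟩
      2 * (2 * Λ + Λ + 9 * Λ)                ≤⟨ widen Λ ⟩
      Λ * 2 ^ 6                              ≡⟨ ^-distribˡ-+-* 2 loglog 6 ⟨
      2 ^ t                                  ∎
      where
      regroup : ∀ l m → 2 * (suc l + (m + 6) + 3) ≡ 2 * (suc l + m + 9 * 1)
      regroup = solve-∀
      widen : ∀ x → 2 * (2 * x + x + 9 * x) ≤ x * 64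
      widen x = ≤-trans (≤-reflexive (twenty-four x)) (*-monoʳ-≤ x (m≤m+n 24 40))
        where
        twenty-four : ∀ x → 2 * (2 * x + x + 9 * x) ≡ x * 24
        twenty-four = solve-∀

  trie-and-replies≤ : 1 ≤ k → E + 2 * k ≤ 24 * (k * (loglog + 1))
  trie-and-replies≤ 1≤k = begin
    2 * (2 * 2 ^ ⌊log₂ k ⌋ + (loglog + 6) * k) + 2 * k
      ≤⟨ +-monoˡ-≤ (2 * k) (*-monoʳ-≤ 2 (+-monoˡ-≤ ((loglog + 6) * k) (*-monoʳ-≤ 2 (2^⌊log₂⌋≤ k 1≤k)))) ⟩
    2 * (2 * k + (loglog + 6) * k) + 2 * k   ≡⟨ regroup k loglog ⟩
    2 * (k * loglog) + 18 * k
      ≤⟨ +-mono-≤ (*-monoˡ-≤ (k * loglog) (m≤m+n 2 22)) (*-monoˡ-≤ k (m≤m+n 18 6)) ⟩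
    24 * (k * loglog) + 24 * k               ≡⟨ regroup′ k loglog ⟩
    24 * (k * (loglog + 1))                  ∎
    where
    open ≤-Reasoning
    regroup : ∀ k l → 2 * (2 * k + (l + 6) * k) + 2 * k ≡ 2 * (k * l) + 18 * k
    regroup = solve-∀
    regroup′ : ∀ k l → 24 * (k * l) + 24 * k ≡ 24 * (k * (l + 1))
    regroup′ = solve-∀

  D≤ : k ≤ n → D ≤ 24 * (⌊log₂ n ⌋ + 1)
  D≤ k≤n = begin
    2 * (L + 1)                          ≡⟨ regroup ⌊log₂ k ⌋ loglog N ⟩
    2 * (⌊log₂ k ⌋ + loglog + 2 * N + 10)
      ≤⟨ *-monoʳ-≤ 2 (+-monoˡ-≤ 10 (+-monoˡ-≤ (2 * N)
                       (+-mono-≤ lk≤N (≤-trans (⌊log₂⌋≤ ⌊log₂ k ⌋) lk≤N)))) ⟩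
    2 * (N + N + 2 * N + 10)             ≤⟨ widen N ⟩
    24 * (N + 1)                         ∎
    where
    open ≤-Reasoning
    N = ⌊log₂ n ⌋
    lk≤N : ⌊log₂ k ⌋ ≤ N
    lk≤N = ⌊log₂⌋-mono-≤ k≤n
    regroup : ∀ l m N → 2 * (suc l + (m + 6) + suc N + suc N + 1) ≡ 2 * (l + m + 2 * N + 10)
    regroup = solve-∀
    widen : ∀ N → 2 * (N + N + 2 * N + 10) ≤ 24 * (N + 1)
    widen N = ≤-trans (≤-reflexive (eight N))
                      (≤-trans (+-mono-≤ (*-monoˡ-≤ N (m≤m+n 8 16)) (m≤m+n 20 4))
                               (≤-reflexive (sym (*-distribˡ-+ 24 N 1))))
      where
      eight : ∀ N → 2 * (N + N + 2 * N + 10) ≡ 8 * N + 20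
      eight = solve-∀

  budget≤ : 1 ≤ k → k ≤ n → ∀ h → E + (k * 2 + h * D) ≤ 24 * (k * (loglog + 1) + h * (⌊log₂ n ⌋ + 1))
  budget≤ 1≤k k≤n h = begin
    E + (k * 2 + h * D)                                   ≡⟨ regroup E k (h * D) ⟩
    (E + 2 * k) + h * D
      ≤⟨ +-mono-≤ (trie-and-replies≤ 1≤k) (*-monoʳ-≤ h (D≤ k≤n)) ⟩
    24 * (k * (loglog + 1)) + h * (24 * (⌊log₂ n ⌋ + 1))      ≡⟨ regroup′ k loglog h ⌊log₂ n ⌋ ⟩
    24 * (k * (loglog + 1) + h * (⌊log₂ n ⌋ + 1))             ∎
    where
    open ≤-Reasoning
    regroup : ∀ e k d → e + (k * 2 + d) ≡ e + 2 * k + d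
    regroup = solve-∀
    regroup′ : ∀ k l h N → 24 * (k * (l + 1)) + h * (24 * (N + 1)) ≡ 24 * (k * (l + 1) + h * (N + 1))
    regroup′ = solve-∀

  collisions : Fin n → Fin n → ℕ
  collisions x y = ∑[ r ∈ allStrings R ] ifAbove p 1 (lcp (hash r x) (hash r y))

  collisions-≤ : ∀ x y → collisions x y ≤ 2 ^ R * (L + 1)
  collisions-≤ x y = ≤-trans (∑-mono-≤ (allStrings R) (λ r → ≤-trans (ifAbove≤ p 1 (lcp (hash r x) (hash r y)))
                                (+-monoˡ-≤ 1 (≤-trans (lcp≤length (hash r x) (hash r y)) (≤-reflexive (length-hash r x))))))
                             (≤-reflexive (∑-allStrings-const R (L + 1)))

  collisions-≢ : ∀ {x y} → x ≢ y → 2 ^ p * collisions x y ≤ 2 ^ R * (p + 3)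
  collisions-≢ {x} {y} x≢y = ≤-trans (Collision.∑lcp-ifAbove-≤ (λ z → bits B (toℕ z)) x≢y p B 1 tails≤B)
                                     (≤-reflexive (cong (2 ^ R *_) (trans (cong (_+ 2) (+-comm 1 p)) (+-assoc p 1 2))))
    where
    tails≤B : lcp (bits B (toℕ x)) (bits B (toℕ y)) ≤ B
    tails≤B = ≤-trans (lcp≤length (bits B (toℕ x)) _) (≤-reflexive (length-bits B (toℕ x)))

  collision-term : ∀ x y → 2 ^ p * ∑[ r ∈ allStrings R ] (2 * ifAbove p 1 (lcp (hash r x) (hash r y)))
                           ≤ indicator (does (x ≟ y)) * (2 ^ p * (2 ^ R * D)) + 2 ^ R * (2 * (p + 3))
  collision-term x y rewrite ∑-*ˡ (allStrings R) 2 (λ r → ifAbove p 1 (lcp (hash r x) (hash r y))) with x ≟ y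
  ... | yes refl = ≤-trans (*-monoʳ-≤ (2 ^ p) (*-monoʳ-≤ 2 (collisions-≤ x x)))
                           (≤-trans (≤-reflexive (regroup (2 ^ p) (2 ^ R) L)) (m≤m+n _ _))
    where
    regroup : ∀ P Q l → P * (2 * (Q * (l + 1))) ≡ 1 * (P * (Q * (2 * (l + 1))))
    regroup = solve-∀
  ... | no  x≢y = ≤-trans (≤-reflexive (swap (2 ^ p) (collisions x y)))
                          (≤-trans (*-monoʳ-≤ 2 (collisions-≢ x≢y)) (≤-reflexive (swap′ (2 ^ R) (p + 3))))
    where
    swap : ∀ P c → P * (2 * c) ≡ 2 * (P * c)
    swap = solve-∀
    swap′ : ∀ Q c → 2 * (Q * c) ≡ Q * (2 * c)
    swap′ = solve-∀

  ∑ˢ-collisions : ∀ X → ∣ X ∣ ≡ k → ∀ y →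
    ∑ˢ[ x ∈ X ] ∑[ r ∈ allStrings R ] (2 * ifAbove p 1 (lcp (hash r x) (hash r y)))
      ≤ indicator (does (y ∈? X)) * (2 ^ R * D) + 2 ^ R
  ∑ˢ-collisions X ∣X∣≡k y = *-cancelˡ-≤ (2 ^ p) {{m^n≢0 2 p}} (begin
    2 ^ p * ∑ˢ X S                                   ≡⟨ ∑ˢ-*ˡ X (2 ^ p) S ⟨
    ∑ˢ[ x ∈ X ] (2 ^ p * S x)                        ≤⟨ ∑ˢ-mono-≤ X (λ x → collision-term x y) ⟩
    ∑ˢ[ x ∈ X ] (indicator (does (x ≟ y)) * W + C)   ≡⟨ ∑ˢ-distrib-+ X _ _ ⟩
    ∑ˢ[ x ∈ X ] (indicator (does (x ≟ y)) * W) + ∑ˢ[ x ∈ X ] C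
      ≡⟨ cong₂ _+_ (∑ˢ-indicator X y W) (trans (∑ˢ-const X C) (cong (_* C) ∣X∣≡k)) ⟩
    indicator (does (y ∈? X)) * W + k * C            ≤⟨ +-monoʳ-≤ _ kC≤ ⟩
    indicator (does (y ∈? X)) * W + 2 ^ p * 2 ^ R    ≡⟨ regroup (indicator (does (y ∈? X))) (2 ^ p) (2 ^ R) D ⟩
    2 ^ p * (indicator (does (y ∈? X)) * (2 ^ R * D) + 2 ^ R) ∎)
    where
    open ≤-Reasoning
    S : Fin n → ℕ
    S x = ∑[ r ∈ allStrings R ] (2 * ifAbove p 1 (lcp (hash r x) (hash r y)))
    W = 2 ^ p * (2 ^ R * D)
    C = 2 ^ R * (2 * (p + 3))
    kC≤ : k * C ≤ 2 ^ p * 2 ^ R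
    kC≤ = ≤-trans (≤-reflexive (rearrange k (2 ^ R) (p + 3))) (*-monoˡ-≤ (2 ^ R) few-collisions)
      where
      rearrange : ∀ k Q q → k * (Q * (2 * q)) ≡ 2 * k * q * Q
      rearrange = solve-∀
    regroup : ∀ i P Q d → i * (P * (Q * d)) + P * Q ≡ P * (i * (Q * d) + Q)
    regroup = solve-∀

  ∑-stageCost : ∀ X → ∣ X ∣ ≡ k → ∀ y →
    ∑[ r ∈ allStrings R ] Run.stageCost r X y ≤ 2 ^ R * (2 + indicator (does (y ∈? X)) * D)
  ∑-stageCost X ∣X∣≡k y = begin
    ∑[ r ∈ allStrings R ] (1 + ∑ˢ[ x ∈ X ] (2 * ifAbove p 1 (lcp (hash r x) (hash r y))))
      ≡⟨ ∑-distrib-+ (allStrings R) _ _ ⟩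
    ∑[ r ∈ allStrings R ] 1 + ∑[ r ∈ allStrings R ] ∑ˢ[ x ∈ X ] (2 * ifAbove p 1 (lcp (hash r x) (hash r y)))
      ≡⟨ cong₂ _+_ (∑-allStrings-const R 1) (∑-∑ˢ-comm (allStrings R) X _) ⟩
    2 ^ R * 1 + ∑ˢ[ x ∈ X ] ∑[ r ∈ allStrings R ] (2 * ifAbove p 1 (lcp (hash r x) (hash r y)))
      ≤⟨ +-monoʳ-≤ (2 ^ R * 1) (∑ˢ-collisions X ∣X∣≡k y) ⟩
    2 ^ R * 1 + (indicator (does (y ∈? X)) * (2 ^ R * D) + 2 ^ R)
      ≡⟨ regroup (2 ^ R) (indicator (does (y ∈? X))) D ⟩
    2 ^ R * (2 + indicator (does (y ∈? X)) * D) ∎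
    where
    open ≤-Reasoning
    regroup : ∀ Q i d → Q * 1 + (i * (Q * d) + Q) ≡ Q * (2 + i * d)
    regroup = solve-∀

  length-trie≤E : ∀ r X → ∣ X ∣ ≡ k → ∀ {x₀} → x₀ ∈ X → length (Run.trie r p [] X) ≤ E
  length-trie≤E r X ∣X∣≡k x₀∈X =
    ≤-trans (m≤m+n _ 2) (≤-trans (Run.length-trie r p [] X (anyˢ-intro _ x₀∈X refl) a)
      (≤-reflexive (cong (λ m → 2 * (2 ^ a + m))
        (cong₂ _*_ (m+n∸m≡n a t) (trans (∑ˢ-const X 1) (trans (*-identityʳ ∣ X ∣) ∣X∣≡k))))))

  ∑-cost≤ : ∀ X → ∣ X ∣ ≡ k → ∀ {x₀} → x₀ ∈ X → ∀ ys →
            ∑[ r ∈ allStrings R ] proj₁ (exec (protocolₙₖ r) X [] ys)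
              ≤ 2 ^ R * (E + ∑[ y ∈ ys ] (2 + indicator (does (y ∈? X)) * D))
  ∑-cost≤ X ∣X∣≡k x₀∈X ys = begin
    ∑[ r ∈ allStrings R ] proj₁ (exec (protocolₙₖ r) X [] ys)
      ≤⟨ ∑-mono-≤ (allStrings R) (λ r → ≤-trans (proj₂ (Run.exec-protocol r X x₀∈X ys))
                                                 (+-monoˡ-≤ _ (length-trie≤E r X ∣X∣≡k x₀∈X))) ⟩
    ∑[ r ∈ allStrings R ] (E + ∑[ y ∈ ys ] Run.stageCost r X y)
      ≡⟨ ∑-distrib-+ (allStrings R) _ _ ⟩
    ∑[ r ∈ allStrings R ] E + ∑[ r ∈ allStrings R ] ∑[ y ∈ ys ] Run.stageCost r X y
      ≡⟨ cong₂ _+_ (∑-allStrings-const R E) (∑-comm (allStrings R) ys _) ⟩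
    2 ^ R * E + ∑[ y ∈ ys ] ∑[ r ∈ allStrings R ] Run.stageCost r X y
      ≤⟨ +-monoʳ-≤ (2 ^ R * E) (∑-mono-≤ ys (∑-stageCost X ∣X∣≡k)) ⟩
    2 ^ R * E + ∑[ y ∈ ys ] (2 ^ R * (2 + indicator (does (y ∈? X)) * D))
      ≡⟨ cong (2 ^ R * E +_) (∑-*ˡ ys (2 ^ R) _) ⟩
    2 ^ R * E + 2 ^ R * ∑[ y ∈ ys ] (2 + indicator (does (y ∈? X)) * D)
      ≡⟨ *-distribˡ-+ (2 ^ R) E _ ⟨
    2 ^ R * (E + ∑[ y ∈ ys ] (2 + indicator (does (y ∈? X)) * D)) ∎
    where open ≤-Reasoning

  correct : ∀ X (Y : Vec (Fin n) k) {x₀} → x₀ ∈ X → ∀ r → outputs protocolₙₖ r X Y ≡ answers X Y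
  correct X Y x₀∈X r = proj₁ (Run.exec-protocol r X x₀∈X (Vec.toList Y))

  totalCost≤ : ∀ X (Y : Vec (Fin n) k) → ∣ X ∣ ≡ k → ∀ {x₀} → x₀ ∈ X →
               totalCost protocolₙₖ X Y ≤ 2 ^ R * (24 * (k * (loglog + 1) + hits X Y * (⌊log₂ n ⌋ + 1)))
  totalCost≤ X Y ∣X∣≡k x₀∈X = ≤-trans (∑-cost≤ X ∣X∣≡k x₀∈X (Vec.toList Y)) (*-monoʳ-≤ (2 ^ R) (begin
    E + ∑[ y ∈ Vec.toList Y ] (2 + indicator (does (y ∈? X)) * D)
      ≡⟨ cong (E +_) (∑-filter (_∈? X) (Vec.toList Y) 2 D) ⟩
    E + (length (Vec.toList Y) * 2 + hits X Y * D)
      ≡⟨ cong (λ m → E + (m * 2 + hits X Y * D)) (length-toList Y) ⟩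
    E + (k * 2 + hits X Y * D)
      ≤⟨ budget≤ 1≤k (subst (_≤ n) ∣X∣≡k (∣p∣≤n X)) (hits X Y) ⟩
    24 * (k * (loglog + 1) + hits X Y * (⌊log₂ n ⌋ + 1)) ∎))
    where
    open ≤-Reasoning
    1≤k : 1 ≤ k
    1≤k = ≤-trans (term≤∑ˢ (λ _ → 1) x₀∈X)
                  (≤-reflexive (trans (∑ˢ-const X 1) (trans (*-identityʳ ∣ X ∣) ∣X∣≡k)))

lemma11 : Σ ℕ λ C → Σ (ℕ → ℕ → ℕ) λ R → Σ ((n k : ℕ) → Protocol n (R n k)) λ P →
    (n k : ℕ) (X : Subset n) (Y : Vec (Fin n) k) → ∣ X ∣ ≡ k →
      ((r : Vec Bool (R n k)) → outputs (P n k) r X Y ≡ answers X Y)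
      × (totalCost (P n k) X Y
          ≤ 2 ^ R n k * (C * (k * (⌊log₂ ⌊log₂ k ⌋ ⌋ + 1) + hits X Y * (⌊log₂ n ⌋ + 1))))
lemma11 = 24 , Construction.R , Construction.protocolₙₖ , λ where
  n zero    X []ᵥ _     → (λ _ → refl) ,
    ≤-trans (≤-reflexive (trans (∑-allStrings-const (Construction.R n 0) 0) (*-zeroʳ (2 ^ Construction.R n 0)))) z≤n
  n (suc k) X Y ∣X∣≡k →
    let _ , x₀∈X = ∣∣≡suc⇒nonempty ∣X∣≡k
    in Construction.correct n (suc k) X Y x₀∈X , Construction.totalCost≤ n (suc k) X Y ∣X∣≡k x₀∈X
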